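{- Suppose that $\mathbb{C}$ is infinitary extensive and has smooth monomorphisms, and that $\Sigma\colon\mathbb{C}\to\mathbb{C}$ preserves monomorphisms and directed colimits. Then for every $X\in\mathbb{C}$, the map $R\mapsto\overline\Sigma R$ from relations on $X$ to relations on $\Sigma X$ preserves directed joins.
   Context: Standing assumptions: $\mathbb{C}$ is complete, has finite coproducts, is well-powered, monomorphisms are stable under finite coproducts, and strong epimorphisms are stable under pullback; every morphism has a (strong epi, mono)-factorization, whose mono part is its image. A relation on $X$ is a subobject $\langle l_R,r_R\rangle\colon R\rightarrowtail X\times X$; relations on $X$ form a complete lattice. The canonical lifting $\overline\Sigma R\rightarrowtail\Sigma X\times\Sigma X$ is the image of $\langle\Sigma l_R,\Sigma r_R\rangle$. Infinitary extensive: small coproducts exist and for every set-indexed family $(X_i)$ the functor $\prod_i\mathbb{C}/X_i\to\mathbb{C}/\coprod_iX_i$, $(p_i)\mapsto\coprod_ip_i$, is an equivalence. Smooth monomorphisms: for every object, the join of a directed family of subobjects is the colimit of the corresponding directed diagram in $\mathbb{C}$. -}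

module Defs where

open import Level using (Level; _⊔_) renaming (suc to lsuc)
open import Data.Product using (Σ; _×_; _,_; proj₁; proj₂)
open import Relation.Binary using (IsEquivalence)

-- Categories.  Convention: a locally small category with hom-setoids;
-- hom-sets and their equality live in  Set ℓ , and "small" (index sets,
-- shapes of diagrams, families) means  Set ℓ  as well.

record Category (o ℓ : Level) : Set (lsuc (o ⊔ ℓ)) where
  infixr 9 _∘_
  infix  4 _≈_ _⇒_
  field
    Obj       : Set o
    _⇒_       : Obj → Obj → Set ℓ
    _≈_       : ∀ {A B} → (A ⇒ B) → (A ⇒ B) → Set ℓ
    id        : ∀ {A} → A ⇒ A
    _∘_       : ∀ {A B C} → (B ⇒ C) → (A ⇒ B) → (A ⇒ C)
    ≈-equiv   : ∀ {A B} → IsEquivalence (_≈_ {A} {B})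
    ∘-resp-≈  : ∀ {A B C} {f h : B ⇒ C} {g i : A ⇒ B} → f ≈ h → g ≈ i → f ∘ g ≈ h ∘ i
    assoc     : ∀ {A B C D} {f : A ⇒ B} {g : B ⇒ C} {h : C ⇒ D} → (h ∘ g) ∘ f ≈ h ∘ (g ∘ f)
    identityˡ : ∀ {A B} {f : A ⇒ B} → id ∘ f ≈ f
    identityʳ : ∀ {A B} {f : A ⇒ B} → f ∘ id ≈ f

  module E {A B : Obj} = IsEquivalence (≈-equiv {A} {B})

-- "raw" categories (data only), used to state that a functor between the
-- categories  ∏ᵢ C/Xᵢ  and  C/∐ᵢXᵢ  is an equivalence.
record RawCat (o ℓ : Level) : Set (lsuc (o ⊔ ℓ)) where
  field
    Obj : Set o
    Hom : Obj → Obj → Set ℓ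
    Eq  : ∀ {A B} → Hom A B → Hom A B → Set ℓ
    idR : ∀ {A} → Hom A A
    cmp : ∀ {A B C} → Hom B C → Hom A B → Hom A C

record IsEquivalenceOfCategories {o₁ ℓ₁ o₂ ℓ₂ : Level}
       (𝔸 : RawCat o₁ ℓ₁) (𝔹 : RawCat o₂ ℓ₂)
       (F₀ : RawCat.Obj 𝔸 → RawCat.Obj 𝔹)
       (F₁ : ∀ {a a'} → RawCat.Hom 𝔸 a a' → RawCat.Hom 𝔹 (F₀ a) (F₀ a'))
       : Set (o₁ ⊔ ℓ₁ ⊔ o₂ ⊔ ℓ₂) where
  module A = RawCat 𝔸
  module B = RawCat 𝔹
  field
    G₀      : B.Obj → A.Obj
    G₁      : ∀ {b b'} → B.Hom b b' → A.Hom (G₀ b) (G₀ b')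
    G-resp  : ∀ {b b'} {g h : B.Hom b b'} → B.Eq g h → A.Eq (G₁ g) (G₁ h)
    G-id    : ∀ {b} → A.Eq (G₁ (B.idR {b})) A.idR
    G-∘     : ∀ {b b' b''} (g : B.Hom b b') (h : B.Hom b' b'') →
              A.Eq (G₁ (B.cmp h g)) (A.cmp (G₁ h) (G₁ g))
    η       : ∀ b → B.Hom (F₀ (G₀ b)) b
    η⁻¹     : ∀ b → B.Hom b (F₀ (G₀ b))
    η-iso₁  : ∀ b → B.Eq (B.cmp (η b) (η⁻¹ b)) B.idR
    η-iso₂  : ∀ b → B.Eq (B.cmp (η⁻¹ b) (η b)) B.idR
    η-nat   : ∀ {b b'} (g : B.Hom b b') → B.Eq (B.cmp g (η b)) (B.cmp (η b') (F₁ (G₁ g)))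
    ε       : ∀ a → A.Hom (G₀ (F₀ a)) a
    ε⁻¹     : ∀ a → A.Hom a (G₀ (F₀ a))
    ε-iso₁  : ∀ a → A.Eq (A.cmp (ε a) (ε⁻¹ a)) A.idR
    ε-iso₂  : ∀ a → A.Eq (A.cmp (ε⁻¹ a) (ε a)) A.idR
    ε-nat   : ∀ {a a'} (f : A.Hom a a') → A.Eq (A.cmp f (ε a)) (A.cmp (ε a') (G₁ (F₁ f)))

record Functor {o ℓ : Level} (C : Category o ℓ) : Set (o ⊔ ℓ) where
  open Category C
  field
    F₀     : Obj → Obj
    F₁     : ∀ {A B} → A ⇒ B → F₀ A ⇒ F₀ B
    F-resp : ∀ {A B} {f g : A ⇒ B} → f ≈ g → F₁ f ≈ F₁ g
    F-id   : ∀ {A} → F₁ (id {A}) ≈ id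
    F-∘    : ∀ {A B C} (f : A ⇒ B) (g : B ⇒ C) → F₁ (g ∘ f) ≈ F₁ g ∘ F₁ f

module _ {o ℓ : Level} (C : Category o ℓ) where
  open Category C

  Mono : ∀ {A B} → A ⇒ B → Set (o ⊔ ℓ)
  Mono {A} f = ∀ {Z} (g h : Z ⇒ A) → f ∘ g ≈ f ∘ h → g ≈ h

  Epi : ∀ {A B} → A ⇒ B → Set (o ⊔ ℓ)
  Epi {B = B} f = ∀ {Z} (g h : B ⇒ Z) → g ∘ f ≈ h ∘ f → g ≈ h

  -- strong epimorphism: epi with the unique diagonal fill-in property
  -- against all monomorphisms (uniqueness is automatic since e is epi)
  StrongEpi : ∀ {A B} → A ⇒ B → Set (o ⊔ ℓ)
  StrongEpi {A} {B} e =
    Epi e ×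
    (∀ {P Q} (m : P ⇒ Q) → Mono m → (u : A ⇒ P) (v : B ⇒ Q) → m ∘ u ≈ v ∘ e →
       Σ (B ⇒ P) λ d → (d ∘ e ≈ u) × (m ∘ d ≈ v))

  record Sub (X : Obj) : Set (o ⊔ ℓ) where
    constructor sub
    field
      dom  : Obj
      arr  : dom ⇒ X
      mono : Mono arr
  open Sub public

  _≤S_ : ∀ {X} → Sub X → Sub X → Set ℓ
  S ≤S T = Σ (dom S ⇒ dom T) λ f → arr T ∘ f ≈ arr S

  IsJoin : ∀ {X} {I : Set ℓ} → (I → Sub X) → Sub X → Set (o ⊔ ℓ)
  IsJoin {X} S J = (∀ i → S i ≤S J) × (∀ (T : Sub X) → (∀ i → S i ≤S T) → J ≤S T)

  Directed : ∀ {X} {I : Set ℓ} → (I → Sub X) → Set ℓ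
  Directed {I = I} S = I × (∀ i j → Σ I λ k → (S i ≤S S k) × (S j ≤S S k))

  IsCocone : {I : Set ℓ} {E : I → I → Set ℓ} (D : I → Obj)
             (map : ∀ {i j} → E i j → D i ⇒ D j) (L : Obj) (c : ∀ i → D i ⇒ L) → Set ℓ
  IsCocone {E = E} D map L c = ∀ {i j} (p : E i j) → c j ∘ map p ≈ c i

  IsColimit : {I : Set ℓ} {E : I → I → Set ℓ} (D : I → Obj)
              (map : ∀ {i j} → E i j → D i ⇒ D j) (L : Obj) (c : ∀ i → D i ⇒ L) → Set (o ⊔ ℓ)
  IsColimit {I} {E} D map L c =
    IsCocone {E = E} D map L c ×
    (∀ (Y : Obj) (d : ∀ i → D i ⇒ Y) → IsCocone {E = E} D map Y d →
       Σ (L ⇒ Y) λ u → (∀ i → u ∘ c i ≈ d i) × (∀ (u' : L ⇒ Y) → (∀ i → u' ∘ c i ≈ d i) → u' ≈ u))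

  IsCone : {I : Set ℓ} {E : I → I → Set ℓ} (D : I → Obj)
           (map : ∀ {i j} → E i j → D i ⇒ D j) (L : Obj) (c : ∀ i → L ⇒ D i) → Set ℓ
  IsCone {E = E} D map L c = ∀ {i j} (p : E i j) → map p ∘ c i ≈ c j

  IsLimit : {I : Set ℓ} {E : I → I → Set ℓ} (D : I → Obj)
            (map : ∀ {i j} → E i j → D i ⇒ D j) (L : Obj) (c : ∀ i → L ⇒ D i) → Set (o ⊔ ℓ)
  IsLimit {I} {E} D map L c =
    IsCone {E = E} D map L c ×
    (∀ (Y : Obj) (d : ∀ i → Y ⇒ D i) → IsCone {E = E} D map Y d →
       Σ (Y ⇒ L) λ u → (∀ i → c i ∘ u ≈ d i) × (∀ (u' : Y ⇒ L) → (∀ i → c i ∘ u' ≈ d i) → u' ≈ u))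

  -- complete: every small diagram has a limit (limits over a small category
  -- are the same as limits over its underlying small graph)
  Complete : Set (o ⊔ lsuc ℓ)
  Complete = ∀ (I : Set ℓ) (E : I → I → Set ℓ) (D : I → Obj)
               (map : ∀ {i j} → E i j → D i ⇒ D j) →
               Σ Obj λ L → Σ (∀ i → L ⇒ D i) λ c → IsLimit {E = E} D map L c

  IsPullback : ∀ {A B Z P} (f : A ⇒ Z) (g : B ⇒ Z) (p : P ⇒ A) (q : P ⇒ B) → Set (o ⊔ ℓ)
  IsPullback {A} {B} {Z} {P} f g p q =
    (f ∘ p ≈ g ∘ q) ×
    (∀ {Y} (a : Y ⇒ A) (b : Y ⇒ B) → f ∘ a ≈ g ∘ b →
       Σ (Y ⇒ P) λ u → (p ∘ u ≈ a) × (q ∘ u ≈ b) ×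
         (∀ (u' : Y ⇒ P) → p ∘ u' ≈ a → q ∘ u' ≈ b → u' ≈ u))

  record InitialObject : Set (o ⊔ ℓ) where
    field
      ⊥       : Obj
      !       : ∀ {A} → ⊥ ⇒ A
      !-unique : ∀ {A} (f : ⊥ ⇒ A) → f ≈ !

  record BinaryProducts : Set (o ⊔ ℓ) where
    infixr 7 _×ₒ_
    field
      _×ₒ_     : Obj → Obj → Obj
      π₁       : ∀ {A B} → A ×ₒ B ⇒ A
      π₂       : ∀ {A B} → A ×ₒ B ⇒ B
      ⟨_,_⟩    : ∀ {A B Z} → Z ⇒ A → Z ⇒ B → Z ⇒ A ×ₒ B
      project₁ : ∀ {A B Z} {f : Z ⇒ A} {g : Z ⇒ B} → π₁ ∘ ⟨ f , g ⟩ ≈ f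
      project₂ : ∀ {A B Z} {f : Z ⇒ A} {g : Z ⇒ B} → π₂ ∘ ⟨ f , g ⟩ ≈ g
      unique   : ∀ {A B Z} {f : Z ⇒ A} {g : Z ⇒ B} {h : Z ⇒ A ×ₒ B} →
                 π₁ ∘ h ≈ f → π₂ ∘ h ≈ g → h ≈ ⟨ f , g ⟩

  record BinaryCoproducts : Set (o ⊔ ℓ) where
    infixr 6 _+ₒ_
    field
      _+ₒ_     : Obj → Obj → Obj
      i₁       : ∀ {A B} → A ⇒ A +ₒ B
      i₂       : ∀ {A B} → B ⇒ A +ₒ B
      [_,_]    : ∀ {A B Z} → A ⇒ Z → B ⇒ Z → A +ₒ B ⇒ Z
      inject₁  : ∀ {A B Z} {f : A ⇒ Z} {g : B ⇒ Z} → [ f , g ] ∘ i₁ ≈ f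
      inject₂  : ∀ {A B Z} {f : A ⇒ Z} {g : B ⇒ Z} → [ f , g ] ∘ i₂ ≈ g
      unique   : ∀ {A B Z} {f : A ⇒ Z} {g : B ⇒ Z} {h : A +ₒ B ⇒ Z} →
                 h ∘ i₁ ≈ f → h ∘ i₂ ≈ g → h ≈ [ f , g ]

    _+₁_ : ∀ {A B A' B'} → A ⇒ A' → B ⇒ B' → A +ₒ B ⇒ A' +ₒ B'
    f +₁ g = [ i₁ ∘ f , i₂ ∘ g ]

  record Coproducts : Set (o ⊔ lsuc ℓ) where
    field
      ∐        : {I : Set ℓ} → (I → Obj) → Obj
      inj      : {I : Set ℓ} {X : I → Obj} (i : I) → X i ⇒ ∐ X
      copair   : {I : Set ℓ} {X : I → Obj} {Y : Obj} → (∀ i → X i ⇒ Y) → ∐ X ⇒ Y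
      copair-β : {I : Set ℓ} {X : I → Obj} {Y : Obj} {f : ∀ i → X i ⇒ Y} (i : I) →
                 copair f ∘ inj i ≈ f i
      copair-unique : {I : Set ℓ} {X : I → Obj} {Y : Obj} {f : ∀ i → X i ⇒ Y} {h : ∐ X ⇒ Y} →
                 (∀ i → h ∘ inj i ≈ f i) → h ≈ copair f

    ∐₁ : {I : Set ℓ} {A X : I → Obj} → (∀ i → A i ⇒ X i) → ∐ A ⇒ ∐ X
    ∐₁ p = copair (λ i → inj i ∘ p i)

  SliceObj : Obj → Set (o ⊔ ℓ)
  SliceObj Y = Σ Obj λ A → A ⇒ Y

  SliceHom : ∀ {Y} → SliceObj Y → SliceObj Y → Set ℓ
  SliceHom (A , p) (B , q) = Σ (A ⇒ B) λ f → q ∘ f ≈ p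

  sliceId : ∀ {Y} {a : SliceObj Y} → SliceHom a a
  sliceId = id , identityʳ

  sliceCmp : ∀ {Y} {a b c : SliceObj Y} → SliceHom b c → SliceHom a b → SliceHom a c
  sliceCmp {a = A , p} {B , q} {D , r} (g , rg) (f , qf) =
    g ∘ f , E.trans (E.sym assoc) (E.trans (∘-resp-≈ rg E.refl) qf)

  Slice : Obj → RawCat (o ⊔ ℓ) ℓ
  Slice Y = record
    { Obj = SliceObj Y
    ; Hom = SliceHom
    ; Eq  = λ f g → proj₁ f ≈ proj₁ g
    ; idR = sliceId
    ; cmp = sliceCmp
    }

  ProdSlice : {I : Set ℓ} → (I → Obj) → RawCat (o ⊔ ℓ) ℓ
  ProdSlice {I} X = record
    { Obj = (i : I) → SliceObj (X i)
    ; Hom = λ a b → (i : I) → SliceHom (a i) (b i)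
    ; Eq  = λ f g → (i : I) → proj₁ (f i) ≈ proj₁ (g i)
    ; idR = λ i → sliceId
    ; cmp = λ g f i → sliceCmp (g i) (f i)
    }

  module CoproductFunctor (CP : Coproducts) where
    open Coproducts CP

    private
      lemma : {I : Set ℓ} {A B X : I → Obj} (p : ∀ i → A i ⇒ X i) (q : ∀ i → B i ⇒ X i)
              (f : ∀ i → A i ⇒ B i) → (∀ i → q i ∘ f i ≈ p i) → ∐₁ q ∘ ∐₁ f ≈ ∐₁ p
      lemma p q f qf = copair-unique λ i →
        E.trans assoc
        (E.trans (∘-resp-≈ E.refl (copair-β i))
        (E.trans (E.sym assoc)
        (E.trans (∘-resp-≈ (copair-β i) E.refl)
        (E.trans assoc (∘-resp-≈ E.refl (qf i))))))

    ∐F₀ : {I : Set ℓ} (X : I → Obj) → RawCat.Obj (ProdSlice X) → RawCat.Obj (Slice (∐ X))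
    ∐F₀ X a = ∐ (λ i → proj₁ (a i)) , ∐₁ (λ i → proj₂ (a i))

    ∐F₁ : {I : Set ℓ} (X : I → Obj) {a b : RawCat.Obj (ProdSlice X)} →
          RawCat.Hom (ProdSlice X) a b → RawCat.Hom (Slice (∐ X)) (∐F₀ X a) (∐F₀ X b)
    ∐F₁ X {a} {b} f =
      ∐₁ (λ i → proj₁ (f i)) ,
      lemma (λ i → proj₂ (a i)) (λ i → proj₂ (b i)) (λ i → proj₁ (f i)) (λ i → proj₂ (f i))

  record InfinitaryExtensive : Set (o ⊔ lsuc ℓ) where
    field
      coproducts : Coproducts
    open CoproductFunctor coproducts
    open Coproducts coproducts
    field
      extensive : {I : Set ℓ} (X : I → Obj) →
                  IsEquivalenceOfCategories (ProdSlice X) (Slice (∐ X)) (∐F₀ X) (∐F₁ X)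

  SmoothMonos : Set (o ⊔ lsuc ℓ)
  SmoothMonos = ∀ {X : Obj} {I : Set ℓ} (S : I → Sub X) → Directed S →
                (J : Sub X) (j : IsJoin S J) →
                IsColimit {E = λ a b → S a ≤S S b} (λ i → dom (S i)) proj₁ (dom J)
                          (λ i → proj₁ (proj₁ j i))

  record DirectedDiagram : Set (o ⊔ lsuc ℓ) where
    field
      I        : Set ℓ
      _≤_      : I → I → Set ℓ
      ≤-refl   : ∀ {i} → i ≤ i
      ≤-trans  : ∀ {i j k} → i ≤ j → j ≤ k → i ≤ k
      inhabited : I
      upper    : ∀ i j → Σ I λ k → (i ≤ k) × (j ≤ k)
      D        : I → Obj
      map      : ∀ {i j} → i ≤ j → D i ⇒ D j
      map-irr  : ∀ {i j} (p q : i ≤ j) → map p ≈ map q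
      map-id   : ∀ {i} → map (≤-refl {i}) ≈ id
      map-∘    : ∀ {i j k} (p : i ≤ j) (q : j ≤ k) → map (≤-trans p q) ≈ map q ∘ map p

  record StandingAssumptions : Set (o ⊔ lsuc ℓ) where
    field
      complete      : Complete
      initial       : InitialObject
      coproducts₂   : BinaryCoproducts
      wellPowered   : ∀ (X : Obj) → Σ (Set ℓ) λ T → Σ (T → Sub X) λ rep →
                        ∀ (S : Sub X) → Σ T λ t → (rep t ≤S S) × (S ≤S rep t)
      monos-stable-+ : ∀ {A B A' B'} {m : A ⇒ A'} {m' : B ⇒ B'} → Mono m → Mono m' →
                        Mono (BinaryCoproducts._+₁_ coproducts₂ m m')
      strongEpi-pullback-stable :
                      ∀ {A B Z P} (e : A ⇒ Z) (f : B ⇒ Z) (p : P ⇒ A) (q : P ⇒ B) →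
                      StrongEpi e → IsPullback e f p q → StrongEpi q
      factorization : ∀ {A B} (f : A ⇒ B) → Σ Obj λ M → Σ (A ⇒ M) λ e → Σ (M ⇒ B) λ m →
                        StrongEpi e × Mono m × (m ∘ e ≈ f)

module _ {o ℓ : Level} {C : Category o ℓ} (F : Functor C) where
  open Category C
  open Functor F

  PreservesMonos : Set (o ⊔ ℓ)
  PreservesMonos = ∀ {A B} {f : A ⇒ B} → Mono C f → Mono C (F₁ f)

  PreservesDirectedColimits : Set (o ⊔ lsuc ℓ)
  PreservesDirectedColimits =
    ∀ (𝔇 : DirectedDiagram C) (L : Obj) (c : ∀ i → DirectedDiagram.D 𝔇 i ⇒ L) →
    IsColimit C {E = DirectedDiagram._≤_ 𝔇} (DirectedDiagram.D 𝔇) (DirectedDiagram.map 𝔇) L c →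
    IsColimit C {E = DirectedDiagram._≤_ 𝔇} (λ i → F₀ (DirectedDiagram.D 𝔇 i))
              (λ p → F₁ (DirectedDiagram.map 𝔇 p)) (F₀ L) (λ i → F₁ (c i))

  -- L is (a representative of) the canonical lifting  F̄R  of the relation R on X:
  -- the image (mono part of a (strong epi, mono)-factorization) of
  -- ⟨ F l_R , F r_R ⟩ : F R → F X × F X
  IsCanonicalLifting : (P : BinaryProducts C) {X : Obj} →
    let open BinaryProducts P in
    Sub C (X ×ₒ X) → Sub C (F₀ X ×ₒ F₀ X) → Set (o ⊔ ℓ)
  IsCanonicalLifting P R L =
    let open BinaryProducts P in
    Σ (F₀ (Sub.dom R) ⇒ Sub.dom L) λ e →
      StrongEpi C e ×
      (Sub.arr L ∘ e ≈ ⟨ F₁ (π₁ ∘ Sub.arr R) , F₁ (π₂ ∘ Sub.arr R) ⟩)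

-- The canonical lifting of R is the image of ⟨F l_R, F r_R⟩, so it lies below a
-- subobject T exactly when ⟨F l_R, F r_R⟩ factors through T. This gives monotonicity,
-- hence the upper bound. For leastness, smoothness makes J the directed colimit of
-- the Rᵢ and F preserves it; the factorisations through an upper bound T form a
-- cocone (T is mono) and glue to a map F J → T that agrees with ⟨F l_J, F r_J⟩ on
-- every colimit leg, after which the strong-epi fill-in gives F̄J ≤ T.
module Submission where

open import Level using (Level)
open import Data.Product using (Σ; _,_; proj₁; proj₂)
open import Relation.Binary.Bundles using (Setoid)
import Relation.Binary.Reasoning.Setoid as SetoidReasoning
open import Defs

module _ {o ℓ : Level} (C : Category o ℓ) where
  open Category C
  open E using (refl; sym; trans)

  hom-setoid : Obj → Obj → Setoid ℓ ℓ
  hom-setoid A B = record { Carrier = A ⇒ B ; _≈_ = _≈_ ; isEquivalence = ≈-equiv }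

  module HomReasoning {A B : Obj} = SetoidReasoning (hom-setoid A B)

  _FactorsThrough_ : ∀ {A Y} → A ⇒ Y → Sub C Y → Set ℓ
  _FactorsThrough_ {A} f T = Σ (A ⇒ dom T) λ d → arr T ∘ d ≈ f

  ≤S-via-strongEpi : ∀ {X A} {S T : Sub C X} {e : A ⇒ dom S} {u : A ⇒ dom T} →
                     StrongEpi C e → arr S ∘ e ≈ arr T ∘ u → _≤S_ C S T
  ≤S-via-strongEpi {S = S} {T} {u = u} (_ , fill) eq
    with fill (arr T) (mono T) u (arr S) (sym eq)
  ... | d , _ , Td≈S = d , Td≈S

  cocone-cancel-mono : ∀ {I : Set ℓ} {E : I → I → Set ℓ} {D : I → Obj}
                       {map : ∀ {i j} → E i j → D i ⇒ D j} {Y Z} {m : Y ⇒ Z}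
                       {d : ∀ i → D i ⇒ Y} {g : ∀ i → D i ⇒ Z} →
                       Mono C m → (∀ i → m ∘ d i ≈ g i) →
                       IsCocone C {E = E} D map Z g → IsCocone C {E = E} D map Y d
  cocone-cancel-mono {map = map} {m = m} {d} {g} m-mono md≈g g-cocone {i} {j} p =
    m-mono (d j ∘ map p) (d i) (begin
      m ∘ (d j ∘ map p) ≈⟨ sym assoc ⟩
      (m ∘ d j) ∘ map p ≈⟨ ∘-resp-≈ (md≈g j) refl ⟩
      g j ∘ map p       ≈⟨ g-cocone p ⟩
      g i               ≈⟨ md≈g i ⟨
      m ∘ d i           ∎)
    where open HomReasoning

  colimit-mediating : ∀ {I : Set ℓ} {E : I → I → Set ℓ} {D : I → Obj}
                      {map : ∀ {i j} → E i j → D i ⇒ D j} {L} {c : ∀ i → D i ⇒ L} →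
                      IsColimit C {E = E} D map L c →
                      ∀ {Y} {d : ∀ i → D i ⇒ Y} → IsCocone C {E = E} D map Y d →
                      Σ (L ⇒ Y) λ u → ∀ i → u ∘ c i ≈ d i
  colimit-mediating (_ , universal) {Y} {d} d-cocone
    with universal Y d d-cocone
  ... | u , u∘c≈d , _ = u , u∘c≈d

  colimit-jointlyEpic : ∀ {I : Set ℓ} {E : I → I → Set ℓ} {D : I → Obj}
                        {map : ∀ {i j} → E i j → D i ⇒ D j} {L} {c : ∀ i → D i ⇒ L} →
                        IsColimit C {E = E} D map L c →
                        ∀ {Y} (f g : L ⇒ Y) → (∀ i → f ∘ c i ≈ g ∘ c i) → f ≈ g
  colimit-jointlyEpic {map = map} {c = c} (c-cocone , universal) {Y} f g f∘c≈g∘c =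
    trans (factor-unique f (λ _ → refl)) (sym (factor-unique g (λ i → sym (f∘c≈g∘c i))))
    where
    f∘c-cocone : ∀ {i j} p → (f ∘ c j) ∘ map p ≈ f ∘ c i
    f∘c-cocone p = trans assoc (∘-resp-≈ refl (c-cocone p))

    factor-unique : ∀ h → (∀ i → h ∘ c i ≈ f ∘ c i) → h ≈ proj₁ (universal Y (λ i → f ∘ c i) f∘c-cocone)
    factor-unique = proj₂ (proj₂ (universal Y (λ i → f ∘ c i) f∘c-cocone))

  subobjectDiagram : ∀ {X} {I : Set ℓ} (S : I → Sub C X) → Directed C S → DirectedDiagram C
  subobjectDiagram {I = I} S (i₀ , upper) = record
    { I         = I
    ; _≤_       = λ i j → _≤S_ C (S i) (S j)
    ; ≤-refl    = id , identityʳ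
    ; ≤-trans   = λ (f , Sf) (g , Sg) → g ∘ f , trans (sym assoc) (trans (∘-resp-≈ Sg refl) Sf)
    ; inhabited = i₀
    ; upper     = upper
    ; D         = λ i → dom (S i)
    ; map       = proj₁
    ; map-irr   = λ {_} {j} (f , Sf) (g , Sg) → mono (S j) f g (trans Sf (sym Sg))
    ; map-id    = refl
    ; map-∘     = λ _ _ → refl
    }

module CanonicalLifting {o ℓ : Level} {C : Category o ℓ} (P : BinaryProducts C) (F : Functor C) where
  open Category C
  open E using (refl; sym; trans)
  open BinaryProducts P
  open Functor F
  open HomReasoning C

  lifted : ∀ {X A} → A ⇒ X ×ₒ X → F₀ A ⇒ F₀ X ×ₒ F₀ X
  lifted m = ⟨ F₁ (π₁ ∘ m) , F₁ (π₂ ∘ m) ⟩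

  lifted-∘ : ∀ {X A B} {m : A ⇒ X ×ₒ X} {k : B ⇒ A} {m' : B ⇒ X ×ₒ X} →
             m ∘ k ≈ m' → lifted m ∘ F₁ k ≈ lifted m'
  lifted-∘ {X} {m = m} {k} {m'} mk≈m' = unique (component project₁) (component project₂)
    where
    component : ∀ {Y} {π : X ×ₒ X ⇒ Y} {πF : F₀ X ×ₒ F₀ X ⇒ F₀ Y} →
                πF ∘ lifted m ≈ F₁ (π ∘ m) → πF ∘ (lifted m ∘ F₁ k) ≈ F₁ (π ∘ m')
    component {π = π} {πF} πF-lifted = begin
      πF ∘ (lifted m ∘ F₁ k) ≈⟨ sym assoc ⟩
      (πF ∘ lifted m) ∘ F₁ k ≈⟨ ∘-resp-≈ πF-lifted refl ⟩
      F₁ (π ∘ m) ∘ F₁ k      ≈⟨ F-∘ k (π ∘ m) ⟨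
      F₁ ((π ∘ m) ∘ k)       ≈⟨ F-resp (trans assoc (∘-resp-≈ refl mk≈m')) ⟩
      F₁ (π ∘ m')            ∎

  ≤S⇒lifted-factors : ∀ {X} {R : Sub C (X ×ₒ X)} {L T : Sub C (F₀ X ×ₒ F₀ X)} →
                      IsCanonicalLifting F P R L → _≤S_ C L T →
                      _FactorsThrough_ C (lifted (arr R)) T
  ≤S⇒lifted-factors (e , _ , Le≈lifted) (t , Tt≈L) =
    t ∘ e , trans (sym assoc) (trans (∘-resp-≈ Tt≈L refl) Le≈lifted)

  lifted-factors⇒≤S : ∀ {X} {R : Sub C (X ×ₒ X)} {L T : Sub C (F₀ X ×ₒ F₀ X)} →
                      IsCanonicalLifting F P R L →
                      _FactorsThrough_ C (lifted (arr R)) T → _≤S_ C L T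
  lifted-factors⇒≤S {L = L} {T} (e , e-strong , Le≈lifted) (_ , Td≈lifted) =
    ≤S-via-strongEpi C {S = L} {T} e-strong (trans Le≈lifted (sym Td≈lifted))

  canonicalLifting-monotone : ∀ {X} {R R' : Sub C (X ×ₒ X)} {L L' : Sub C (F₀ X ×ₒ F₀ X)} →
                              IsCanonicalLifting F P R L → IsCanonicalLifting F P R' L' →
                              _≤S_ C R R' → _≤S_ C L L'
  canonicalLifting-monotone {R = R} {R'} {L} {L'} R↦L (e' , _ , L'e'≈lifted) (k , R'k≈R) =
    lifted-factors⇒≤S {R = R} {L} {L'} R↦L (e' ∘ F₁ k , (begin
      arr L' ∘ (e' ∘ F₁ k)   ≈⟨ sym assoc ⟩
      (arr L' ∘ e') ∘ F₁ k   ≈⟨ ∘-resp-≈ L'e'≈lifted refl ⟩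
      lifted (arr R') ∘ F₁ k ≈⟨ lifted-∘ R'k≈R ⟩
      lifted (arr R)         ∎))

  canonicalLifting-least :
    ∀ {X} {I : Set ℓ} {R : I → Sub C (X ×ₒ X)} {J : Sub C (X ×ₒ X)} (k : ∀ i → _≤S_ C (R i) J) →
    IsColimit C {E = λ i j → _≤S_ C (R i) (R j)} (λ i → F₀ (dom (R i))) (λ p → F₁ (proj₁ p))
              (F₀ (dom J)) (λ i → F₁ (proj₁ (k i))) →
    {L : I → Sub C (F₀ X ×ₒ F₀ X)} → (∀ i → IsCanonicalLifting F P (R i) (L i)) →
    {LJ : Sub C (F₀ X ×ₒ F₀ X)} → IsCanonicalLifting F P J LJ →
    (T : Sub C (F₀ X ×ₒ F₀ X)) → (∀ i → _≤S_ C (L i) T) → _≤S_ C LJ T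
  canonicalLifting-least {X} {R = R} {J} k colimit {L} R↦L {LJ} J↦LJ T L≤T =
    lifted-factors⇒≤S {R = J} {LJ} {T} J↦LJ (u , T∘u≈lifted)
    where
    factor : ∀ i → _FactorsThrough_ C (lifted (arr (R i))) T
    factor i = ≤S⇒lifted-factors {R = R i} {L i} {T} (R↦L i) (L≤T i)

    lifted-cocone : IsCocone C {E = λ i j → _≤S_ C (R i) (R j)} (λ i → F₀ (dom (R i)))
                             (λ p → F₁ (proj₁ p)) (F₀ X ×ₒ F₀ X) (λ i → lifted (arr (R i)))
    lifted-cocone (_ , Rf≈R) = lifted-∘ Rf≈R

    mediating : Σ (F₀ (dom J) ⇒ dom T) λ u → ∀ i → u ∘ F₁ (proj₁ (k i)) ≈ proj₁ (factor i)
    mediating = colimit-mediating C colimit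
                  (cocone-cancel-mono C (mono T) (λ i → proj₂ (factor i)) lifted-cocone)

    u : F₀ (dom J) ⇒ dom T
    u = proj₁ mediating

    T∘u≈lifted : arr T ∘ u ≈ lifted (arr J)
    T∘u≈lifted = colimit-jointlyEpic C colimit (arr T ∘ u) (lifted (arr J)) λ i → begin
      (arr T ∘ u) ∘ F₁ (proj₁ (k i))   ≈⟨ assoc ⟩
      arr T ∘ (u ∘ F₁ (proj₁ (k i)))   ≈⟨ ∘-resp-≈ refl (proj₂ mediating i) ⟩
      arr T ∘ proj₁ (factor i)         ≈⟨ proj₂ (factor i) ⟩
      lifted (arr (R i))               ≈⟨ lifted-∘ (proj₂ (k i)) ⟨
      lifted (arr J) ∘ F₁ (proj₁ (k i)) ∎

open CanonicalLifting

lemmaB8 : ∀ {o ℓ : Level} (C : Category o ℓ) → StandingAssumptions C →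
          (P : BinaryProducts C) →
          InfinitaryExtensive C → SmoothMonos C →
          (F : Functor C) → PreservesMonos F → PreservesDirectedColimits F →
          ∀ (X : Category.Obj C) {I : Set ℓ}
            (R : I → Sub C (BinaryProducts._×ₒ_ P X X)) → Directed C R →
            (J : Sub C (BinaryProducts._×ₒ_ P X X)) → IsJoin C R J →
            (L : I → Sub C (BinaryProducts._×ₒ_ P (Functor.F₀ F X) (Functor.F₀ F X))) →
            (∀ i → IsCanonicalLifting F P (R i) (L i)) →
            (LJ : Sub C (BinaryProducts._×ₒ_ P (Functor.F₀ F X) (Functor.F₀ F X))) →
            IsCanonicalLifting F P J LJ →
            IsJoin C L LJ
lemmaB8 C _ P _ smooth F _ preservesColimits X R directed J R-join@(R≤J , _) L R↦L LJ J↦LJ =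
  (λ i → canonicalLifting-monotone P F {R = R i} {J} {L i} {LJ} (R↦L i) J↦LJ (R≤J i)) ,
  canonicalLifting-least P F {R = R} {J} R≤J
    (preservesColimits (subobjectDiagram C R directed) (Sub.dom J) (λ i → proj₁ (R≤J i))
       (smooth R directed J R-join))
    {L} R↦L {LJ} J↦LJ
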